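{- All LTL temporal operators $\mathsf{X},\mathsf{F},\mathsf{G},\mathsf{U},\mathsf{W},\mathsf{M},\mathsf{R}$ can be equivalently defined in $\mathrm{TEL}_{\mathbb{N}^+}$: for every LTL formula $\varphi$ over $\Sigma$ there is a $\mathrm{TEL}_{\mathbb{N}^+}$ formula $\varphi'$ over $\Sigma$ without free time variables such that for every $\omega$-word $\alpha\in\Sigma^\omega$ and every $i\ge1$, $(\alpha,i)\models\varphi$ (LTL) iff $(\alpha,i)\models\varphi'$ ($\mathrm{TEL}_{\mathbb{N}^+}$).
   Context: LTL formulas over $\Sigma$: $\varphi::=a\mid\neg a\mid\neg\varphi\mid\varphi\wedge\varphi\mid\varphi\vee\varphi\mid\mathsf{X}\varphi\mid\mathsf{F}\varphi\mid\mathsf{G}\varphi\mid\varphi\mathsf{U}\varphi\mid\varphi\mathsf{W}\varphi\mid\varphi\mathsf{M}\varphi\mid\varphi\mathsf{R}\varphi$ ($a\in\Sigma$). For $\alpha=\sigma[1]\sigma[2]\cdots$ and $i\ge1$, with $k,j$ ranging over $\mathbb{N}=\{0,1,\dots\}$: $(\alpha,i)\models a$ iff $\sigma[i]=a$; $\neg a$ iff $\sigma[i]\ne a$; Boolean connectives as usual; $\mathsf{X}\varphi$ iff $(\alpha,i+1)\models\varphi$; $\mathsf{F}\varphi$ iff $\exists k\,(\alpha,i+k)\models\varphi$; $\mathsf{G}\varphi$ iff $\forall k\,(\alpha,i+k)\models\varphi$; $\varphi\mathsf{U}\psi$ iff $\exists k\,[(\alpha,i+k)\models\psi$ and $\forall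 j<k\,(\alpha,i+j)\models\varphi]$; $\varphi\mathsf{W}\psi$ iff $(\alpha,i)\models\mathsf{G}\varphi$ or $(\alpha,i)\models\varphi\mathsf{U}\psi$; $\varphi\mathsf{M}\psi$ iff $\exists k\,[(\alpha,i+k)\models\varphi$ and $\forall j\le k\,(\alpha,i+j)\models\psi]$; $\varphi\mathsf{R}\psi$ iff $(\alpha,i)\models\mathsf{G}\psi$ or $(\alpha,i)\models\varphi\mathsf{M}\psi$. $\mathrm{TEL}_{\mathbb{N}^+}$ over $\Sigma$: time terms $u,v::=i\mid x\mid u+v$ ($i\in\mathbb{N}^+$, $x$ a time variable); formulas $\varphi::=a\mid\varphi_t\mid\neg\varphi\mid\varphi\wedge\psi\mid\varphi\vee\psi\mid\Box_t\varphi\mid\Diamond_t\varphi\mid\forall x\varphi\mid\exists x\varphi$; semantics: $(\alpha,i)\models a$ iff $\sigma[i]=a$; $(\alpha,i)\models\varphi_t$ iff $(\alpha,i+t)\models\varphi$; Boolean as usual; $\Box_t\varphi$ iff $\varphi$ holds at all $j$ with $i\le j<i+t$; $\Diamond_t\varphi$ iff at some such $j$; $\forall x\varphi$ / $\exists x\varphi$ iff $\varphi[x:=k]$ holds at $i$ for all / some $k\ge1$. -}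

module Defs where

open import Data.Nat using (ℕ; zero; suc; _+_; _≤_; _<_; NonZero)
open import Data.Fin using (Fin)
open import Data.Product using (Σ; _×_; ∃-syntax)
open import Data.Sum using (_⊎_)
open import Relation.Nullary using (¬_)
open import Relation.Binary.PropositionalEquality using (_≡_; _≢_)

-- ω-words over Σ: position i ≥ 1 carries the letter α i (α 0 is irrelevant).
Word : Set → Set
Word Σ = ℕ → Σ

data LTL (Σ : Set) : Set where
  atom  : Σ → LTL Σ
  natom : Σ → LTL Σ
  ¬'_   : LTL Σ → LTL Σ
  _∧'_  : LTL Σ → LTL Σ → LTL Σ
  _∨'_  : LTL Σ → LTL Σ → LTL Σ
  X     : LTL Σ → LTL Σ
  F     : LTL Σ → LTL Σ
  G     : LTL Σ → LTL Σ
  _U_   : LTL Σ → LTL Σ → LTL Σ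
  _W_   : LTL Σ → LTL Σ → LTL Σ
  _M_   : LTL Σ → LTL Σ → LTL Σ
  _R_   : LTL Σ → LTL Σ → LTL Σ

_,_⊨L_ : {Σ : Set} → Word Σ → ℕ → LTL Σ → Set
α , i ⊨L atom a  = α i ≡ a
α , i ⊨L natom a = α i ≢ a
α , i ⊨L (¬' φ)  = ¬ (α , i ⊨L φ)
α , i ⊨L (φ ∧' ψ) = (α , i ⊨L φ) × (α , i ⊨L ψ)
α , i ⊨L (φ ∨' ψ) = (α , i ⊨L φ) ⊎ (α , i ⊨L ψ)
α , i ⊨L X φ     = α , suc i ⊨L φ
α , i ⊨L F φ     = ∃[ k ] (α , i + k ⊨L φ)
α , i ⊨L G φ     = ∀ k → α , i + k ⊨L φ
α , i ⊨L (φ U ψ) = ∃[ k ] ((α , i + k ⊨L ψ) × (∀ j → j < k → α , i + j ⊨L φ))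
α , i ⊨L (φ W ψ) = (∀ k → α , i + k ⊨L φ)
                   ⊎ (∃[ k ] ((α , i + k ⊨L ψ) × (∀ j → j < k → α , i + j ⊨L φ)))
α , i ⊨L (φ M ψ) = ∃[ k ] ((α , i + k ⊨L φ) × (∀ j → j ≤ k → α , i + j ⊨L ψ))
α , i ⊨L (φ R ψ) = (∀ k → α , i + k ⊨L ψ)
                   ⊎ (∃[ k ] ((α , i + k ⊨L φ) × (∀ j → j ≤ k → α , i + j ⊨L ψ)))

-- TEL_{ℕ⁺}, well-scoped: TEL Σ n has at most n time variables in scope
-- (de Bruijn indices Fin n); TEL Σ 0 = formulas without free time variables.

data Term (n : ℕ) : Set where
  lit  : (k : ℕ) → .{{NonZero k}} → Term n
  var  : Fin n → Term n
  _⊕_  : Term n → Term n → Term n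

data TEL (Σ : Set) : ℕ → Set where
  atom  : ∀ {n} → Σ → TEL Σ n
  _at_  : ∀ {n} → TEL Σ n → Term n → TEL Σ n
  ¬'_   : ∀ {n} → TEL Σ n → TEL Σ n
  _∧'_  : ∀ {n} → TEL Σ n → TEL Σ n → TEL Σ n
  _∨'_  : ∀ {n} → TEL Σ n → TEL Σ n → TEL Σ n
  □     : ∀ {n} → Term n → TEL Σ n → TEL Σ n
  ◇     : ∀ {n} → Term n → TEL Σ n → TEL Σ n
  ∀'    : ∀ {n} → TEL Σ (suc n) → TEL Σ n
  ∃'    : ∀ {n} → TEL Σ (suc n) → TEL Σ n

Env : ℕ → Set
Env n = Fin n → ℕ

extend : ∀ {n} → ℕ → Env n → Env (suc n)
extend k ρ Fin.zero    = k
extend k ρ (Fin.suc x) = ρ x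

⟦_⟧ : ∀ {n} → Term n → Env n → ℕ
⟦ lit k ⟧ ρ   = k
⟦ var x ⟧ ρ   = ρ x
⟦ t ⊕ u ⟧ ρ   = ⟦ t ⟧ ρ + ⟦ u ⟧ ρ

Sat : {Σ : Set} {n : ℕ} → Word Σ → Env n → ℕ → TEL Σ n → Set
Sat α ρ i (atom a)  = α i ≡ a
Sat α ρ i (φ at t)  = Sat α ρ (i + ⟦ t ⟧ ρ) φ
Sat α ρ i (¬' φ)    = ¬ Sat α ρ i φ
Sat α ρ i (φ ∧' ψ)  = Sat α ρ i φ × Sat α ρ i ψ
Sat α ρ i (φ ∨' ψ)  = Sat α ρ i φ ⊎ Sat α ρ i ψ
Sat α ρ i (□ t φ)   = ∀ j → i ≤ j → j < i + ⟦ t ⟧ ρ → Sat α ρ j φ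
Sat α ρ i (◇ t φ)   = ∃[ j ] (i ≤ j × j < i + ⟦ t ⟧ ρ × Sat α ρ j φ)
Sat α ρ i (∀' φ)    = ∀ k → 1 ≤ k → Sat α (extend k ρ) i φ
Sat α ρ i (∃' φ)    = ∃[ k ] (1 ≤ k × Sat α (extend k ρ) i φ)

emptyEnv : Env 0
emptyEnv ()

_,_⊨T_ : {Σ : Set} → Word Σ → ℕ → TEL Σ 0 → Set
α , i ⊨T φ = Sat α emptyEnv i φ

-- LTL operators quantify over offsets k ∈ ℕ, TEL over durations x ∈ ℕ⁺.  G φ and F φ become
-- ∀x □_x φ and ∃x ◇_x φ, because the windows [i, i + x) exhaust the positions from i on.  In
-- φ U ψ the offset 0 needs its own disjunct: ∃x (ψ ∨ (ψ_x ∧ □_x φ)).  φ M ψ is ψ U (φ ∧ ψ),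
-- since ψ at all j ≤ k means ψ at k and at all j < k, and W, R are G ∨ U and G ∨ M.  Translated
-- formulas never mention the time variables bound around them, so their meaning does not
-- depend on the environment, which is what lets a subformula sit under a fresh binder.
module Submission where

open import Defs
open import Data.Nat using (ℕ; zero; suc; _+_; _≤_; _<_; z≤n; s≤s)
open import Data.Nat.Properties
  using ( +-identityʳ; +-comm; m≤m+n; n<1+n; +-monoʳ-<; +-cancelˡ-<; ≤-refl; <⇒≤
        ; m≤n⇒∃[o]m+o≡n; m≤n⇒m<n∨m≡n)
open import Data.Fin using (Fin)
open import Data.Product using (Σ; _,_; _×_; ∃-syntax)
open import Data.Product.Function.NonDependent.Propositional using (_×-⇔_)
open import Data.Sum using (_⊎_; inj₁; inj₂)
open import Data.Sum.Function.Propositional using (_⊎-⇔_)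
open import Function.Bundles using (_⇔_; mk⇔; Equivalence)
open import Function.Related.TypeIsomorphisms using (¬-cong-⇔)
import Function.Properties.Equivalence as ⇔
open import Relation.Nullary using (¬_)
open import Relation.Binary.PropositionalEquality using (refl; sym; subst)

open Equivalence

∀-window : ∀ {Q : ℕ → Set} {i k} →
           (∀ d → d < k → Q (i + d)) ⇔ (∀ j → i ≤ j → j < i + k → Q j)
∀-window {Q} {i} {k} = mk⇔ to′ (λ f d d<k → f (i + d) (m≤m+n i d) (+-monoʳ-< i d<k))
  where
  to′ : (∀ d → d < k → Q (i + d)) → ∀ j → i ≤ j → j < i + k → Q j
  to′ f j i≤j j<i+k with m≤n⇒∃[o]m+o≡n i≤j
  ... | d , refl = f d (+-cancelˡ-< i d k j<i+k)

∃-window : ∀ {Q : ℕ → Set} {i k} →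
           (∃[ d ] (d < k × Q (i + d))) ⇔ (∃[ j ] (i ≤ j × j < i + k × Q j))
∃-window {Q} {i} {k} = mk⇔ (λ (d , d<k , q) → i + d , m≤m+n i d , +-monoʳ-< i d<k , q) from′
  where
  from′ : ∃[ j ] (i ≤ j × j < i + k × Q j) → ∃[ d ] (d < k × Q (i + d))
  from′ (j , i≤j , j<i+k , q) with m≤n⇒∃[o]m+o≡n i≤j
  ... | d , refl = d , +-cancelˡ-< i d k j<i+k , q

∀≤⇔last×∀< : ∀ {Q : ℕ → Set} {k} → (∀ j → j ≤ k → Q j) ⇔ (Q k × (∀ j → j < k → Q j))
∀≤⇔last×∀< {Q} {k} = mk⇔ (λ f → f k ≤-refl , λ j j<k → f j (<⇒≤ j<k)) from′
  where
  from′ : Q k × (∀ j → j < k → Q j) → ∀ j → j ≤ k → Q j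
  from′ (q , f) j j≤k with m≤n⇒m<n∨m≡n j≤k
  ... | inj₁ j<k  = f j j<k
  ... | inj₂ refl = q

-- A TEL formula available in every scope, so that it can be placed under fresh binders
-- without weakening; the translation produces only such formulas.
Formula : Set → Set
Formula Sig = (n : ℕ) → TEL Sig n

module _ {Sig : Set} where

  infixr 6 _∧ᶠ_
  infixr 5 _∨ᶠ_
  infix  4 _Uᶠ_ _Mᶠ_

  ¬ᶠ_ : Formula Sig → Formula Sig
  (¬ᶠ φ) n = ¬' φ n

  _∧ᶠ_ _∨ᶠ_ : Formula Sig → Formula Sig → Formula Sig
  (φ ∧ᶠ ψ) n = φ n ∧' ψ n
  (φ ∨ᶠ ψ) n = φ n ∨' ψ n

  Xᶠ Fᶠ Gᶠ : Formula Sig → Formula Sig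
  Xᶠ φ n = φ n at lit 1
  Fᶠ φ n = ∃' (◇ (var Fin.zero) (φ (suc n)))
  Gᶠ φ n = ∀' (□ (var Fin.zero) (φ (suc n)))

  _Uᶠ_ _Mᶠ_ : Formula Sig → Formula Sig → Formula Sig
  (φ Uᶠ ψ) n = ∃' (ψ (suc n) ∨' ((ψ (suc n) at var Fin.zero) ∧' □ (var Fin.zero) (φ (suc n))))
  φ Mᶠ ψ = ψ Uᶠ (φ ∧ᶠ ψ)

  translate : LTL Sig → Formula Sig
  translate (atom a)  n = atom a
  translate (natom a) n = ¬' atom a
  translate (¬' φ)    = ¬ᶠ translate φ
  translate (φ ∧' ψ)  = translate φ ∧ᶠ translate ψ
  translate (φ ∨' ψ)  = translate φ ∨ᶠ translate ψ
  translate (X φ)     = Xᶠ (translate φ)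
  translate (F φ)     = Fᶠ (translate φ)
  translate (G φ)     = Gᶠ (translate φ)
  translate (φ U ψ)   = translate φ Uᶠ translate ψ
  translate (φ W ψ)   = Gᶠ (translate φ) ∨ᶠ (translate φ Uᶠ translate ψ)
  translate (φ M ψ)   = translate φ Mᶠ translate ψ
  translate (φ R ψ)   = Gᶠ (translate ψ) ∨ᶠ (translate φ Mᶠ translate ψ)

private variable
  Sig : Set
  φ ψ : Formula Sig
  P Q : ℕ → Set

module _ (α : Word Sig) where

  record _Expresses_ (φ : Formula Sig) (P : ℕ → Set) : Set where
    constructor expresses
    field meaning : ∀ n (ρ : Env n) i → P i ⇔ Sat α ρ i (φ n)

  Expresses-resp : (∀ i → P i ⇔ Q i) → φ Expresses P → φ Expresses Q
  Expresses-resp P⇔Q (expresses φ≈P) =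
    expresses λ n ρ i → ⇔.trans (⇔.sym (P⇔Q i)) (φ≈P n ρ i)

  ¬ᶠ-expresses : φ Expresses P → (¬ᶠ φ) Expresses (λ i → ¬ P i)
  ¬ᶠ-expresses (expresses φ≈P) = expresses λ n ρ i → ¬-cong-⇔ (φ≈P n ρ i)

  ∧ᶠ-expresses : φ Expresses P → ψ Expresses Q → (φ ∧ᶠ ψ) Expresses (λ i → P i × Q i)
  ∧ᶠ-expresses (expresses φ≈P) (expresses ψ≈Q) = expresses λ n ρ i → φ≈P n ρ i ×-⇔ ψ≈Q n ρ i

  ∨ᶠ-expresses : φ Expresses P → ψ Expresses Q → (φ ∨ᶠ ψ) Expresses (λ i → P i ⊎ Q i)
  ∨ᶠ-expresses (expresses φ≈P) (expresses ψ≈Q) = expresses λ n ρ i → φ≈P n ρ i ⊎-⇔ ψ≈Q n ρ i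

  Xᶠ-expresses : φ Expresses P → Xᶠ φ Expresses (λ i → P (suc i))
  Xᶠ-expresses {φ = φ} {P = P} (expresses φ≈P) = expresses λ n ρ i →
    subst (λ j → P j ⇔ Sat α ρ (i + 1) (φ n)) (+-comm i 1) (φ≈P n ρ (i + 1))

  Fᶠ-expresses : φ Expresses P → Fᶠ φ Expresses (λ i → ∃[ k ] P (i + k))
  Fᶠ-expresses (expresses φ≈P) = expresses λ n ρ i → mk⇔
    (λ (d , p) → suc d , s≤s z≤n ,
       to ∃-window (d , n<1+n d , to (φ≈P (suc n) (extend (suc d) ρ) (i + d)) p))
    (λ (x , _ , w) → let (d , _ , s) = from ∃-window w in
       d , from (φ≈P (suc n) (extend x ρ) (i + d)) s)

  Gᶠ-expresses : φ Expresses P → Gᶠ φ Expresses (λ i → ∀ k → P (i + k))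
  Gᶠ-expresses (expresses φ≈P) = expresses λ n ρ i → mk⇔
    (λ p x _ → to ∀-window (λ d _ → to (φ≈P (suc n) (extend x ρ) (i + d)) (p d)))
    (λ s d → from (φ≈P (suc n) (extend (suc d) ρ) (i + d))
                  (from ∀-window (s (suc d) (s≤s z≤n)) d (n<1+n d)))

  Uᶠ-expresses : φ Expresses P → ψ Expresses Q →
                 (φ Uᶠ ψ) Expresses (λ i → ∃[ k ] (Q (i + k) × (∀ j → j < k → P (i + j))))
  Uᶠ-expresses {φ = φ} {P = P} {ψ = ψ} {Q = Q} (expresses φ≈P) (expresses ψ≈Q) =
    expresses λ n ρ i → mk⇔ (to′ n ρ i) (from′ n ρ i)
    where
    to′ : ∀ n (ρ : Env n) i →
          ∃[ k ] (Q (i + k) × (∀ j → j < k → P (i + j))) → Sat α ρ i ((φ Uᶠ ψ) n)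
    to′ n ρ i (zero , q , _) =
      1 , s≤s z≤n , inj₁ (to (ψ≈Q (suc n) (extend 1 ρ) i) (subst Q (+-identityʳ i) q))
    to′ n ρ i (k@(suc _) , q , p) = k , s≤s z≤n , inj₂
      ( to (ψ≈Q (suc n) (extend k ρ) (i + k)) q
      , to ∀-window (λ d d<k → to (φ≈P (suc n) (extend k ρ) (i + d)) (p d d<k)))

    from′ : ∀ n (ρ : Env n) i →
            Sat α ρ i ((φ Uᶠ ψ) n) → ∃[ k ] (Q (i + k) × (∀ j → j < k → P (i + j)))
    from′ n ρ i (x , _ , inj₁ s) =
      zero , subst Q (sym (+-identityʳ i)) (from (ψ≈Q (suc n) (extend x ρ) i) s) , λ _ ()
    from′ n ρ i (x , _ , inj₂ (s , w)) =
      x , from (ψ≈Q (suc n) (extend x ρ) (i + x)) s ,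
      λ d d<x → from (φ≈P (suc n) (extend x ρ) (i + d)) (from ∀-window w d d<x)

  Mᶠ-expresses : φ Expresses P → ψ Expresses Q →
                 (φ Mᶠ ψ) Expresses (λ i → ∃[ k ] (P (i + k) × (∀ j → j ≤ k → Q (i + j))))
  Mᶠ-expresses {P = P} {Q = Q} φ≈P ψ≈Q =
    Expresses-resp M-as-U (Uᶠ-expresses ψ≈Q (∧ᶠ-expresses φ≈P ψ≈Q))
    where
    M-as-U : ∀ i → (∃[ k ] ((P (i + k) × Q (i + k)) × (∀ j → j < k → Q (i + j))))
                 ⇔ (∃[ k ] (P (i + k) × (∀ j → j ≤ k → Q (i + j))))
    M-as-U i = mk⇔
      (λ (k , (p , q) , qs) → k , p , from ∀≤⇔last×∀< (q , qs))
      (λ (k , p , qs) → let (q , qs′) = to ∀≤⇔last×∀< qs in k , (p , q) , qs′)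

  translate-expresses : ∀ φ → translate φ Expresses (α ,_⊨L φ)
  translate-expresses (atom a)  = expresses λ _ _ _ → ⇔.refl
  translate-expresses (natom a) = expresses λ _ _ _ → ⇔.refl
  translate-expresses (¬' φ)    = ¬ᶠ-expresses (translate-expresses φ)
  translate-expresses (φ ∧' ψ)  = ∧ᶠ-expresses (translate-expresses φ) (translate-expresses ψ)
  translate-expresses (φ ∨' ψ)  = ∨ᶠ-expresses (translate-expresses φ) (translate-expresses ψ)
  translate-expresses (X φ)     = Xᶠ-expresses (translate-expresses φ)
  translate-expresses (F φ)     = Fᶠ-expresses (translate-expresses φ)
  translate-expresses (G φ)     = Gᶠ-expresses (translate-expresses φ)
  translate-expresses (φ U ψ)   = Uᶠ-expresses (translate-expresses φ) (translate-expresses ψ)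
  translate-expresses (φ W ψ)   =
    ∨ᶠ-expresses (Gᶠ-expresses (translate-expresses φ))
                 (Uᶠ-expresses (translate-expresses φ) (translate-expresses ψ))
  translate-expresses (φ M ψ)   = Mᶠ-expresses (translate-expresses φ) (translate-expresses ψ)
  translate-expresses (φ R ψ)   =
    ∨ᶠ-expresses (Gᶠ-expresses (translate-expresses ψ))
                 (Mᶠ-expresses (translate-expresses φ) (translate-expresses ψ))

-- The translation is faithful at every position.
mainTheorem8 : (Sig : Set) (φ : LTL Sig) →
    Σ (TEL Sig 0) (λ φ′ → (α : Word Sig) (i : ℕ) → 1 ≤ i →
    ((α , i ⊨L φ) ⇔ (α , i ⊨T φ′)))
mainTheorem8 Sig φ = translate φ 0 , λ α i _ →
  _Expresses_.meaning (translate-expresses α φ) 0 emptyEnv i
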